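{- Let $k\ge 1$ and $S_1,S_2\subseteq\{1,\dots,k-1\}$. Then $n(\ell_{k,S_1},\ell_{k,S_2})=c_k^{S_1\cap S_2}$.
   Context: A rooted tree is a finite tree with a distinguished vertex (the root); its leaves are the non-root vertices of degree $1$, and an internal edge is an edge not incident to a leaf. Given rooted trees $t_1,t_2$ with the same number of leaves, a gluing is a bijection $\sigma$ from the leaves of $t_1$ to the leaves of $t_2$; its associated graph is obtained from the disjoint union of $t_1$ and $t_2$ by identifying each leaf $u$ of $t_1$ with $\sigma(u)$ and then suppressing each resulting 2-valent vertex, so that each glued pair becomes a single edge joining the parent of $u$ to the parent of $\sigma(u)$. The gluing has a subdivergence if there exist an internal edge $e_1$ of $t_1$ and an internal edge $e_2$ of $t_2$ such that $\{e_1,e_2\}$ is a 2-edge cut of this graph and one of the two resulting components contains neither root. $n(t_1,t_2)$ is the number of gluings (bijections) with no subdivergence. For $S=\{s_1<\dots<s_j\}\subseteq\{1,\dots,k-1\}$ (possibly empty), set $s_0=0$, $s_{j+1}=k$; $\ell_{k,S}$ is the rooted tree with $j+1$ internal vertices $v_0,v_1,\dots,v_j$ forming a path with $v_0$ the root, where $v_m$ has exactly $s_{j-m+1}-s_{j-m}$ leaf children (and $v_{m+1}$ as its only other child for $m<j$). A permutation $\sigma$ of $\{1,\dots,k\}$ fixes a prefix of size $i$ if $\sigma(\{1,\dots,i\})=\{1,\dots,i\}$; for $T\subseteq\{1,\dots,k-1\}$, $c_k^T$ is the number of permutations of $\{1,\dots,k\}$ fixing no prefix of size $i$ for any $i\in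 T$. -}

module Defs where

open import Data.Nat using (ℕ; zero; suc; _<_; _∸_; s≤s)
open import Data.Nat.Properties using (m∸n≤m)
open import Data.Bool using (true; false)
open import Data.Fin using (Fin; zero; suc; toℕ; inject₁; fromℕ<)
open import Data.Fin.Subset using (Subset; _∈_; ∣_∣)
open import Data.Vec using (Vec; []; _∷_; lookup)
open import Data.Sum using (_⊎_; inj₁; inj₂)
open import Data.Product using (Σ; _×_; _,_)
open import Relation.Nullary using (¬_)
open import Relation.Binary.PropositionalEquality using (_≡_; _≢_)
open import Relation.Binary.Construct.Closure.ReflexiveTransitive using (Star)
open import Function.Definitions using (Bijective)

-- Internal (= non-leaf) vertices are Fin (suc m); the root is `zero`,
-- and `suc i` (i : Fin m) are the non-root internal vertices.
--   ipar i : parent of internal vertex (suc i)   (internal edges)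
--   lpar u : parent of leaf u                     (leaf edges)
-- (A well-formed tree additionally has toℕ (ipar i) ≤ toℕ i and every
-- non-root internal vertex has a child; the trees used below satisfy this.)
record LTree (k : ℕ) : Set where
  field
    m    : ℕ
    ipar : Fin m → Fin (suc m)
    lpar : Fin k → Fin (suc m)

module Glue {k : ℕ} (t₁ t₂ : LTree k) (σ : Fin k → Fin k) where
  open LTree

  Vtx : Set
  Vtx = Fin (suc (m t₁)) ⊎ Fin (suc (m t₂))

  -- internal edges of t₁, internal edges of t₂, glued leaf pairs
  Edge : Set
  Edge = Fin (m t₁) ⊎ (Fin (m t₂) ⊎ Fin k)

  ends : Edge → Vtx × Vtx
  ends (inj₁ i)        = inj₁ (suc i) , inj₁ (ipar t₁ i)
  ends (inj₂ (inj₁ i)) = inj₂ (suc i) , inj₂ (ipar t₂ i)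
  ends (inj₂ (inj₂ u)) = inj₁ (lpar t₁ u) , inj₂ (lpar t₂ (σ u))

  root₁ root₂ : Vtx
  root₁ = inj₁ zero
  root₂ = inj₂ zero

  Adj : Edge → Edge → Vtx → Vtx → Set
  Adj d₁ d₂ x y = Σ Edge λ e → e ≢ d₁ × e ≢ d₂ × (ends e ≡ (x , y) ⊎ ends e ≡ (y , x))

  Conn : Edge → Edge → Vtx → Vtx → Set
  Conn d₁ d₂ = Star (Adj d₁ d₂)

  -- {e₁,e₂} (e₁ internal in t₁, e₂ internal in t₂) is a 2-edge cut whose
  -- removal leaves (exactly) two components, one of which contains no root.
  Subdivergence : Set
  Subdivergence =
    Σ (Fin (m t₁)) λ i₁ → Σ (Fin (m t₂)) λ i₂ →
      (∀ x y z → Conn (inj₁ i₁) (inj₂ (inj₁ i₂)) x y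
               ⊎ Conn (inj₁ i₁) (inj₂ (inj₁ i₂)) y z
               ⊎ Conn (inj₁ i₁) (inj₂ (inj₁ i₂)) x z)
      × (Σ Vtx λ x → ¬ Conn (inj₁ i₁) (inj₂ (inj₁ i₂)) x root₁
                   × ¬ Conn (inj₁ i₁) (inj₂ (inj₁ i₂)) x root₂)

-- "the number of maps Fin k → Fin k satisfying P is N"
-- (maps compared extensionally).
HasCount : (k : ℕ) → ((Fin k → Fin k) → Set) → ℕ → Set
HasCount k P N =
  Σ (Vec (Fin k → Fin k) N) λ v →
      (∀ i → P (lookup v i))
    × (∀ i j → (∀ x → lookup v i x ≡ lookup v j x) → i ≡ j)
    × (∀ f → P f → Σ (Fin N) λ i → ∀ x → f x ≡ lookup v i x)

NCount : {k : ℕ} → LTree k → LTree k → ℕ → Set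
NCount {k} t₁ t₂ N =
  HasCount k (λ σ → Bijective _≡_ _≡_ σ × ¬ Glue.Subdivergence t₁ t₂ σ) N

-- σ fixes the prefix of size i (0-indexed: {0,…,i-1})
FixesPrefix : {k : ℕ} → (Fin k → Fin k) → ℕ → Set
FixesPrefix σ i =
    (∀ x → toℕ x < i → toℕ (σ x) < i)
  × (∀ y → toℕ y < i → Σ _ λ x → toℕ x < i × σ x ≡ y)

-- Subsets of {1,…,k-1} for k = suc k': element j : Fin k' stands for j+1.
-- c_k^T = N
CCount : (k' : ℕ) → Subset k' → ℕ → Set
CCount k' T N =
  HasCount (suc k')
    (λ σ → Bijective _≡_ _≡_ σ × (∀ j → j ∈ T → ¬ FixesPrefix σ (suc (toℕ j))))
    N

-- below S u = #{ s ∈ S : s ≤ u }  (s as element of {1,…,k-1}, i.e. j+1 ≤ u)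
below : {n : ℕ} → Subset n → ℕ → ℕ
below []          _       = 0
below (_ ∷ S)     zero    = 0
below (true ∷ S)  (suc u) = suc (below S u)
below (false ∷ S) (suc u) = below S u

-- Internal vertices v₀ (root) … v_j, j = |S|, with
-- v_{i+1} a child of v_i.  Leaf u (value u+1 ∈ {1,…,k}) lies in block
-- (s_t, s_{t+1}] with t = below S u, hence hangs off v_{j-t}.
ladder : (k' : ℕ) → Subset k' → LTree (suc k')
ladder k' S = record
  { m    = ∣ S ∣
  ; ipar = inject₁
  ; lpar = λ u → fromℕ< (s≤s (m∸n≤m ∣ S ∣ (below S (toℕ u))))
  }

{-# OPTIONS --safe #-}
-- In the graph of a gluing of ℓ_{k,S₁} and ℓ_{k,S₂}, deleting the internal edge of ℓ_{k,S}
-- sitting at s ∈ S cuts off exactly the leaves of the prefix {1,…,s} below it.  A pair of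
-- internal edges is therefore a subdivergence precisely when the two cut-off leaf sets
-- correspond under the gluing: both edges sit at the same s ∈ S₁ ∩ S₂ (the prefixes must
-- have the same size), and σ fixes the prefix of size s.  So both n(ℓ_{k,S₁},ℓ_{k,S₂}) and
-- c_k^{S₁∩S₂} count the same permutations, and that number exists because the predicate is
-- decidable on the finitely many maps Fin k → Fin k.
module Submission where

open import Defs
open import Data.Nat using (ℕ; zero; suc; _<_; _≤_; _∸_; _+_; _≤?_; _<?_; z≤n; s≤s; s≤s⁻¹; z<s)
open import Data.Nat.Properties
  using (≤-refl; ≤-trans; ≤-antisym; ≰⇒>; ≮⇒≥; <⇒≤; <⇒≱; ≤∧≢⇒<; 1+n≰n; suc-injective; m<n⇒m<1+n;
         +-suc; +-cancelˡ-≤; +-monoʳ-≤; m∸n+n≡m; m+[n∸m]≡n; ∸-monoʳ-<;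
         m+n≤o⇒m≤o∸n; m≤o∸n⇒m+n≤o)
open import Data.Bool using (true; false)
open import Data.Fin using (Fin; zero; suc; toℕ; fromℕ<; fromℕ; inject₁)
open import Data.Fin.Properties
  using (toℕ<n; toℕ-fromℕ<; toℕ-fromℕ; toℕ-inject₁; toℕ-injective; fromℕ<-injective;
         injective⇒≤; all?; any?; _≟_)
open import Data.Fin.Subset using (Subset; _∈_; ∣_∣; _∩_)
open import Data.Fin.Subset.Properties using (_∈?_; x∈p∩q⁺; x∈p∩q⁻)
open import Data.Vec using (Vec; []; _∷_; lookup; here; there)
open import Data.Vec.Functional using (tail) renaming (_∷_ to _◂_)
open import Data.List using (List; []; _∷_; allFin; cartesianProductWith)
open import Data.List.Relation.Unary.Any using (Any; here; there)
open import Data.List.Relation.Unary.Any.Properties using (cartesianProductWith⁺)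
open import Data.List.Membership.Propositional.Properties using (∈-allFin)
open import Data.Product using (Σ; ∃; _×_; _,_; proj₁; proj₂)
open import Data.Sum using (_⊎_; inj₁; inj₂; swap)
open import Data.Empty using (⊥-elim)
open import Function using (_∘_)
open import Function.Bundles using (_⇔_; mk⇔; Equivalence)
open import Function.Definitions using (Injective; Surjective; Bijective)
import Function.Properties.Equivalence as ⇔
open import Relation.Nullary using (¬_; Dec; yes; no; contradiction)
open import Relation.Nullary.Decidable using (_→-dec_; _×-dec_; ¬?; map′)
open import Level using (0ℓ)
open import Relation.Unary using (Pred; Decidable)
open import Relation.Binary.PropositionalEquality using (_≡_; _≢_; refl; sym; trans; cong; subst; _≗_)
open import Relation.Binary.Construct.Closure.ReflexiveTransitive using (ε; _◅_; _◅◅_; reverse)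

open Equivalence using (to; from)

-- Counting maps with a decidable property

allFunctions : (n m : ℕ) → List (Fin n → Fin m)
allFunctions zero    m = (λ ()) ∷ []
allFunctions (suc n) m = cartesianProductWith _◂_ (allFin m) (allFunctions n m)

allFunctions-complete : ∀ n m (f : Fin n → Fin m) → Any (f ≗_) (allFunctions n m)
allFunctions-complete zero    m f = here (λ ())
allFunctions-complete (suc n) m f =
  cartesianProductWith⁺ _◂_ split (∈-allFin (f zero)) (allFunctions-complete n m (tail f))
  where
    split : ∀ {a g} → f zero ≡ a → tail f ≗ g → f ≗ a ◂ g
    split refl tail-f≗g zero    = refl
    split refl tail-f≗g (suc x) = tail-f≗g x

module Counting {n : ℕ} {P : Pred (Fin n → Fin n) 0ℓ} (P? : Decidable P)
                (P-resp : ∀ {f g} → f ≗ g → P f → P g) where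

  CountIn : List (Fin n → Fin n) → ℕ → Set
  CountIn L N =
    Σ (Vec (Fin n → Fin n) N) λ v →
        (∀ i → P (lookup v i))
      × (∀ i j → lookup v i ≗ lookup v j → i ≡ j)
      × (∀ f → P f → Any (f ≗_) L → Σ (Fin N) λ i → f ≗ lookup v i)

  countIn : (L : List (Fin n → Fin n)) → ∃ (CountIn L)
  countIn []      = 0 , [] , (λ ()) , (λ ()) , (λ _ _ ())
  countIn (g ∷ L) with countIn L
  ... | N , v , all-P , distinct , covers
      with P? g | any? (λ i → all? (λ x → g x ≟ lookup v i x))
  ... | no ¬Pg | _ = N , v , all-P , distinct , covers′
    where
      covers′ : ∀ f → P f → Any (f ≗_) (g ∷ L) → Σ (Fin N) λ i → f ≗ lookup v i
      covers′ f Pf (here f≗g)  = ⊥-elim (¬Pg (P-resp f≗g Pf))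
      covers′ f Pf (there f∈L) = covers f Pf f∈L
  ... | yes _ | yes (i , g≗vᵢ) = N , v , all-P , distinct , covers′
    where
      covers′ : ∀ f → P f → Any (f ≗_) (g ∷ L) → Σ (Fin N) λ i → f ≗ lookup v i
      covers′ f Pf (here f≗g)  = i , λ x → trans (f≗g x) (g≗vᵢ x)
      covers′ f Pf (there f∈L) = covers f Pf f∈L
  ... | yes Pg | no g∉v = suc N , g ∷ v , all-P′ , distinct′ , covers′
    where
      all-P′ : ∀ i → P (lookup (g ∷ v) i)
      all-P′ zero    = Pg
      all-P′ (suc i) = all-P i
      distinct′ : ∀ i j → lookup (g ∷ v) i ≗ lookup (g ∷ v) j → i ≡ j
      distinct′ zero    zero    _ = refl
      distinct′ zero    (suc j) e = ⊥-elim (g∉v (j , e))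
      distinct′ (suc i) zero    e = ⊥-elim (g∉v (i , sym ∘ e))
      distinct′ (suc i) (suc j) e = cong suc (distinct i j e)
      covers′ : ∀ f → P f → Any (f ≗_) (g ∷ L) → Σ (Fin (suc N)) λ i → f ≗ lookup (g ∷ v) i
      covers′ f Pf (here f≗g)  = zero , f≗g
      covers′ f Pf (there f∈L) with covers f Pf f∈L
      ... | i , f≗vᵢ = suc i , f≗vᵢ

  count : ∃ (HasCount n P)
  count with countIn (allFunctions n n)
  ... | N , v , all-P , distinct , covers =
    N , v , all-P , distinct , λ f Pf → covers f Pf (allFunctions-complete n n f)

HasCount-cong : ∀ {n N} {P Q : Pred (Fin n → Fin n) 0ℓ} →
  (∀ f → P f ⇔ Q f) → HasCount n P N → HasCount n Q N
HasCount-cong P⇔Q (v , all-P , distinct , covers) =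
  v , (λ i → to (P⇔Q _) (all-P i)) , distinct , λ f Qf → covers f (from (P⇔Q f) Qf)

module _ {n m : ℕ} (f : Fin n → Fin m) where

  injective? : Dec (Injective _≡_ _≡_ f)
  injective? = map′ (λ inj {x} {y} → inj x y) (λ inj x y → inj)
    (all? λ x → all? λ y → (f x ≟ f y) →-dec (x ≟ y))

  surjective? : Dec (Surjective _≡_ _≡_ f)
  surjective? = map′ (λ sur y → proj₁ (sur y) , λ { refl → proj₂ (sur y) })
                     (λ sur y → proj₁ (sur y) , proj₂ (sur y) refl)
    (all? λ y → any? λ x → f x ≟ y)

  bijective? : Dec (Bijective _≡_ _≡_ f)
  bijective? = injective? ×-dec surjective?

module _ {n : ℕ} {f g : Fin n → Fin n} (f≗g : f ≗ g) where

  bijective-resp-≗ : Bijective _≡_ _≡_ f → Bijective _≡_ _≡_ g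
  bijective-resp-≗ (inj , sur) =
    (λ {x} {y} gx≡gy → inj (trans (f≗g x) (trans gx≡gy (sym (f≗g y))))) ,
    λ y → proj₁ (sur y) , λ z≡x → trans (sym (f≗g _)) (proj₂ (sur y) z≡x)

  fixesPrefix-resp-≗ : ∀ {i} → FixesPrefix g i → FixesPrefix f i
  fixesPrefix-resp-≗ {i} (closed , onto) =
    (λ x x<i → subst (λ y → toℕ y < i) (sym (f≗g x)) (closed x x<i)) ,
    λ y y<i → let (x , x<i , gx≡y) = onto y y<i in x , x<i , trans (f≗g x) gx≡y

fixesPrefix? : ∀ {n} (f : Fin n → Fin n) i → Dec (FixesPrefix f i)
fixesPrefix? f i =
      all? (λ x → (toℕ x <? i) →-dec (toℕ (f x) <? i))
  ×-dec all? (λ y → (toℕ y <? i) →-dec any? λ x → (toℕ x <? i) ×-dec (f x ≟ y))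

FixesNoPrefixIn : ∀ {k'} → Subset k' → (Fin (suc k') → Fin (suc k')) → Set
FixesNoPrefixIn T σ = ∀ j → j ∈ T → ¬ FixesPrefix σ (suc (toℕ j))

PrefixAvoiding : ∀ {k'} → Subset k' → Pred (Fin (suc k') → Fin (suc k')) 0ℓ
PrefixAvoiding T σ = Bijective _≡_ _≡_ σ × FixesNoPrefixIn T σ

prefixAvoiding? : ∀ {k'} (T : Subset k') → Decidable (PrefixAvoiding T)
prefixAvoiding? T σ =
  bijective? σ ×-dec all? λ j → (j ∈? T) →-dec ¬? (fixesPrefix? σ (suc (toℕ j)))

prefixAvoiding-resp-≗ : ∀ {k'} (T : Subset k') {σ τ} → σ ≗ τ → PrefixAvoiding T σ → PrefixAvoiding T τ
prefixAvoiding-resp-≗ T σ≗τ (bij , avoids) =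
  bijective-resp-≗ σ≗τ bij , λ j j∈T τ-fixes → avoids j j∈T (fixesPrefix-resp-≗ σ≗τ τ-fixes)

prefix-injection⇒≤ : ∀ {n m a b} {f : Fin n → Fin m} → Injective _≡_ _≡_ f → a < n →
  (∀ u → toℕ u ≤ a → toℕ (f u) ≤ b) → a ≤ b
prefix-injection⇒≤ {n} {a = a} {b = b} {f = f} f-inj a<n f-prefix =
  s≤s⁻¹ (injective⇒≤ restriction-injective)
  where
    embed : Fin (suc a) → Fin n
    embed c = fromℕ< (≤-trans (toℕ<n c) a<n)

    embed-≤ : ∀ c → toℕ (embed c) ≤ a
    embed-≤ c = subst (_≤ a) (sym (toℕ-fromℕ< _)) (s≤s⁻¹ (toℕ<n c))

    restriction : Fin (suc a) → Fin (suc b)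
    restriction c = fromℕ< (s≤s (f-prefix (embed c) (embed-≤ c)))

    restriction-injective : Injective _≡_ _≡_ restriction
    restriction-injective eq =
      toℕ-injective (fromℕ<-injective _ _ _ _ (f-inj (toℕ-injective (fromℕ<-injective _ _ _ _ eq))))

<suc⇔<inject₁ : ∀ {m} {r i : Fin m} → i ≢ r → toℕ r < toℕ (suc i) ⇔ toℕ r < toℕ (inject₁ i)
<suc⇔<inject₁ {i = i} i≢r = mk⇔
  (λ r<1+i → subst (_ <_) (sym (toℕ-inject₁ i))
    (≤∧≢⇒< (s≤s⁻¹ r<1+i) (λ r≡i → i≢r (sym (toℕ-injective r≡i)))))
  (λ r<i → m<n⇒m<1+n (subst (_ <_) (toℕ-inject₁ i) r<i))

-- Ranks in a subset: below S u counts the j ∈ S with toℕ j < u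

below-mono : ∀ {n} (S : Subset n) {u v} → u ≤ v → below S u ≤ below S v
below-mono []          u≤v       = z≤n
below-mono (_ ∷ S)     {zero} _  = z≤n
below-mono (true ∷ S)  (s≤s u≤v) = s≤s (below-mono S u≤v)
below-mono (false ∷ S) (s≤s u≤v) = below-mono S u≤v

below-≤-size : ∀ {n} (S : Subset n) u → below S u ≤ ∣ S ∣
below-≤-size []          u       = z≤n
below-≤-size (_ ∷ S)     zero    = z≤n
below-≤-size (true ∷ S)  (suc u) = s≤s (below-≤-size S u)
below-≤-size (false ∷ S) (suc u) = below-≤-size S u

below-zero : ∀ {n} (S : Subset n) → below S 0 ≡ 0
below-zero []      = refl
below-zero (_ ∷ S) = refl

below-suc-∈ : ∀ {n} (S : Subset n) {j} → j ∈ S → below S (suc (toℕ j)) ≡ suc (below S (toℕ j))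
below-suc-∈ (true ∷ S)  here       = cong suc (below-zero S)
below-suc-∈ (true ∷ S)  (there j∈S) = cong suc (below-suc-∈ S j∈S)
below-suc-∈ (false ∷ S) (there j∈S) = below-suc-∈ S j∈S

below-∈-< : ∀ {n} (S : Subset n) {j} → j ∈ S → below S (toℕ j) < ∣ S ∣
below-∈-< S {j} j∈S = subst (_≤ ∣ S ∣) (below-suc-∈ S j∈S) (below-≤-size S (suc (toℕ j)))

below-surjective : ∀ {n} (S : Subset n) c → c < ∣ S ∣ → Σ (Fin n) λ j → j ∈ S × below S (toℕ j) ≡ c
below-surjective (true ∷ S)  zero    _         = zero , here , refl
below-surjective (true ∷ S)  (suc c) (s≤s c<) with below-surjective S c c<
... | j , j∈S , rank = suc j , there j∈S , cong suc rank
below-surjective (false ∷ S) c       c<        with below-surjective S c c<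
... | j , j∈S , rank = suc j , there j∈S , rank

below-≤-∈⇔≤ : ∀ {n} (S : Subset n) {j} → j ∈ S → ∀ u → below S u ≤ below S (toℕ j) ⇔ u ≤ toℕ j
below-≤-∈⇔≤ S {j} j∈S u = mk⇔ reflect (below-mono S)
  where
    reflect : below S u ≤ below S (toℕ j) → u ≤ toℕ j
    reflect rank≤ with u ≤? toℕ j
    ... | yes u≤j = u≤j
    ... | no  u≰j = contradiction rank≤
      (<⇒≱ (subst (_≤ below S u) (below-suc-∈ S j∈S) (below-mono S (≰⇒> u≰j))))

-- Internal edge i of ℓ_{k,S} joins v_{i+1} to v_i.  It sits at the element j ∈ S of rank
-- ∣S∣-1-i: deleting it separates the leaves {0,…,j} (the paper's {1,…,j+1}) from the root.
EdgeCutsPrefix : ∀ {k'} (S : Subset k') → Fin ∣ S ∣ → Fin k' → Set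
EdgeCutsPrefix S i j = j ∈ S × suc (toℕ i) + below S (toℕ j) ≡ ∣ S ∣

edgeCutsSomePrefix : ∀ {k'} (S : Subset k') i → ∃ (EdgeCutsPrefix S i)
edgeCutsSomePrefix S i with below-surjective S (∣ S ∣ ∸ suc (toℕ i)) (∸-monoʳ-< z<s (toℕ<n i))
... | j , j∈S , rank = j , j∈S , subst (λ r → suc (toℕ i) + r ≡ ∣ S ∣) (sym rank) (m+[n∸m]≡n (toℕ<n i))

prefixCutBySomeEdge : ∀ {k'} (S : Subset k') {j} → j ∈ S → ∃ λ i → EdgeCutsPrefix S i j
prefixCutBySomeEdge S {j} j∈S = fromℕ< i<∣S∣ , j∈S , i+rank
  where
    rank = below S (toℕ j)
    rank<∣S∣ : rank < ∣ S ∣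
    rank<∣S∣ = below-∈-< S j∈S
    i<∣S∣ : ∣ S ∣ ∸ suc rank < ∣ S ∣
    i<∣S∣ = ∸-monoʳ-< z<s rank<∣S∣
    i+rank : suc (toℕ (fromℕ< i<∣S∣)) + rank ≡ ∣ S ∣
    i+rank rewrite toℕ-fromℕ< i<∣S∣ = trans (sym (+-suc _ rank)) (m∸n+n≡m rank<∣S∣)

leafBelowEdge⇔inPrefix : ∀ {k'} (S : Subset k') {i j} → EdgeCutsPrefix S i j →
  ∀ u → toℕ i < toℕ (LTree.lpar (ladder k' S) u) ⇔ toℕ u ≤ toℕ j
leafBelowEdge⇔inPrefix S {i} {j} (j∈S , i+rank) u =
  ⇔.trans (mk⇔ (subst (toℕ i <_) (toℕ-fromℕ< _)) (subst (toℕ i <_) (sym (toℕ-fromℕ< _))))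
  (⇔.trans below-edge⇔rank-≤ (below-≤-∈⇔≤ S j∈S (toℕ u)))
  where
    b = below S (toℕ u)
    -- both sides say suc i + b ≤ ∣S∣ = suc i + rank
    below-edge⇔rank-≤ : toℕ i < ∣ S ∣ ∸ b ⇔ b ≤ below S (toℕ j)
    below-edge⇔rank-≤ = mk⇔
      (λ i<∣S∣∸b → +-cancelˡ-≤ (suc (toℕ i)) b _
        (subst (suc (toℕ i) + b ≤_) (sym i+rank)
          (m≤o∸n⇒m+n≤o (suc (toℕ i)) (below-≤-size S (toℕ u)) i<∣S∣∸b)))
      (λ b≤rank → m+n≤o⇒m≤o∸n (suc (toℕ i))
        (subst (suc (toℕ i) + b ≤_) i+rank (+-monoʳ-≤ (suc (toℕ i)) b≤rank)))

-- Gluing graphs of two ladders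

module LadderGluing {k' : ℕ} (S₁ S₂ : Subset k') (σ : Fin (suc k') → Fin (suc k')) where

  open Glue (ladder k' S₁) (ladder k' S₂) σ

  lp₁ : Fin (suc k') → Fin (suc ∣ S₁ ∣)
  lp₁ = LTree.lpar (ladder k' S₁)

  lp₂ : Fin (suc k') → Fin (suc ∣ S₂ ∣)
  lp₂ = LTree.lpar (ladder k' S₂)

  module Cut (i₁ : Fin ∣ S₁ ∣) (i₂ : Fin ∣ S₂ ∣) where

    Step Path : Vtx → Vtx → Set
    Step = Adj (inj₁ i₁) (inj₂ (inj₁ i₂))
    Path = Conn (inj₁ i₁) (inj₂ (inj₁ i₂))

    reversePath : ∀ {x y} → Path x y → Path y x
    reversePath = reverse λ { (e , e≢₁ , e≢₂ , e-ends) → e , e≢₁ , e≢₂ , swap e-ends }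

    lower₁ lower₂ : Vtx
    lower₁ = inj₁ (suc i₁)
    lower₂ = inj₂ (suc i₂)

    module Spine {m : ℕ} (vtx : Fin (suc m) → Vtx) (r : Fin m)
      (edge : ∀ i → i ≢ r → Step (vtx (suc i)) (vtx (inject₁ i))) where

      -- Both walks recurse on the fuel n = toℕ v, as inject₁ i is not structurally smaller.
      toTop : ∀ v → toℕ v ≤ toℕ r → Path (vtx v) (vtx zero)
      toTop v = go (toℕ v) v refl
        where
          go : ∀ n v → toℕ v ≡ n → toℕ v ≤ toℕ r → Path (vtx v) (vtx zero)
          go _       zero    _ _ = ε
          go (suc n) (suc i) v≡n i<r =
            edge i (λ { refl → 1+n≰n i<r }) ◅
            go n (inject₁ i) (trans (toℕ-inject₁ i) (suc-injective v≡n))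
              (subst (_≤ toℕ r) (sym (toℕ-inject₁ i)) (<⇒≤ i<r))

      toLower : ∀ v → toℕ r < toℕ v → Path (vtx v) (vtx (suc r))
      toLower v = go (toℕ v) v refl
        where
          go : ∀ n v → toℕ v ≡ n → toℕ r < toℕ v → Path (vtx v) (vtx (suc r))
          go (suc n) (suc i) v≡n r<v with i ≟ r
          ... | yes refl = ε
          ... | no  i≢r  =
            edge i i≢r ◅
            go n (inject₁ i) (trans (toℕ-inject₁ i) (suc-injective v≡n))
              (subst (toℕ r <_) (sym (toℕ-inject₁ i))
                (≤∧≢⇒< (s≤s⁻¹ r<v) (λ r≡i → i≢r (sym (toℕ-injective r≡i)))))

      reachesTopOrLower : ∀ v → Path (vtx v) (vtx zero) ⊎ Path (vtx v) (vtx (suc r))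
      reachesTopOrLower v with toℕ v ≤? toℕ r
      ... | yes v≤r = inj₁ (toTop v v≤r)
      ... | no  v≰r = inj₂ (toLower v (≰⇒> v≰r))

    spineStep₁ : ∀ i → i ≢ i₁ → Step (inj₁ (suc i)) (inj₁ (inject₁ i))
    spineStep₁ i i≢i₁ = inj₁ i , (λ { refl → i≢i₁ refl }) , (λ ()) , inj₁ refl

    spineStep₂ : ∀ i → i ≢ i₂ → Step (inj₂ (suc i)) (inj₂ (inject₁ i))
    spineStep₂ i i≢i₂ = inj₂ (inj₁ i) , (λ ()) , (λ { refl → i≢i₂ refl }) , inj₁ refl

    open Spine inj₁ i₁ spineStep₁
      public renaming (toTop to toRoot₁; toLower to toLower₁; reachesTopOrLower to reaches₁)
    open Spine inj₂ i₂ spineStep₂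
      public renaming (toTop to toRoot₂; toLower to toLower₂; reachesTopOrLower to reaches₂)

    glueEdge : ∀ u → Path (inj₁ (lp₁ u)) (inj₂ (lp₂ (σ u)))
    glueEdge u = (inj₂ (inj₂ u) , (λ ()) , (λ ()) , inj₁ refl) ◅ ε

    module Leaves {j₁ j₂ : Fin k'} (cut₁ : EdgeCutsPrefix S₁ i₁ j₁) (cut₂ : EdgeCutsPrefix S₂ i₂ j₂) where

      belowCut₁⇔inPrefix : ∀ u → toℕ i₁ < toℕ (lp₁ u) ⇔ toℕ u ≤ toℕ j₁
      belowCut₁⇔inPrefix = leafBelowEdge⇔inPrefix S₁ cut₁

      belowCut₂⇔inPrefix : ∀ u → toℕ i₂ < toℕ (lp₂ u) ⇔ toℕ u ≤ toℕ j₂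
      belowCut₂⇔inPrefix = leafBelowEdge⇔inPrefix S₂ cut₂

      leaf₁→lower : ∀ u → toℕ u ≤ toℕ j₁ → Path (inj₁ (lp₁ u)) lower₁
      leaf₁→lower u u≤j = toLower₁ (lp₁ u) (from (belowCut₁⇔inPrefix u) u≤j)

      leaf₂→lower : ∀ u → toℕ u ≤ toℕ j₂ → Path (inj₂ (lp₂ u)) lower₂
      leaf₂→lower u u≤j = toLower₂ (lp₂ u) (from (belowCut₂⇔inPrefix u) u≤j)

      leaf₁→root : ∀ u → toℕ j₁ < toℕ u → Path (inj₁ (lp₁ u)) root₁
      leaf₁→root u j<u = toRoot₁ (lp₁ u) (≮⇒≥ (λ under → <⇒≱ j<u (to (belowCut₁⇔inPrefix u) under)))

      leaf₂→root : ∀ u → toℕ j₂ < toℕ u → Path (inj₂ (lp₂ u)) root₂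
      leaf₂→root u j<u = toRoot₂ (lp₂ u) (≮⇒≥ (λ under → <⇒≱ j<u (to (belowCut₂⇔inPrefix u) under)))

  commonFixedPrefix⇒subdivergence : Injective _≡_ _≡_ σ → ∀ {j} → j ∈ S₁ → j ∈ S₂ →
    FixesPrefix σ (suc (toℕ j)) → Subdivergence
  commonFixedPrefix⇒subdivergence σ-inj {j} j∈S₁ j∈S₂ (closed , onto) =
    i₁ , i₂ , atMostTwoComponents , lower₁ , lower₁-isolated (λ ()) , lower₁-isolated (λ ())
    where
      i₁ = proj₁ (prefixCutBySomeEdge S₁ j∈S₁)
      i₂ = proj₁ (prefixCutBySomeEdge S₂ j∈S₂)
      open Cut i₁ i₂
      open Leaves (proj₂ (prefixCutBySomeEdge S₁ j∈S₁)) (proj₂ (prefixCutBySomeEdge S₂ j∈S₂))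

      σ-prefix⇔ : ∀ u → toℕ (σ u) ≤ toℕ j ⇔ toℕ u ≤ toℕ j
      σ-prefix⇔ u = mk⇔ back (λ u≤j → s≤s⁻¹ (closed u (s≤s u≤j)))
        where
          back : toℕ (σ u) ≤ toℕ j → toℕ u ≤ toℕ j
          back σu≤j with onto (σ u) (s≤s σu≤j)
          ... | x , x≤j , σx≡σu = subst (λ y → toℕ y ≤ toℕ j) (σ-inj σx≡σu) (s≤s⁻¹ x≤j)

      Lower : Vtx → Set
      Lower (inj₁ v) = toℕ i₁ < toℕ v
      Lower (inj₂ v) = toℕ i₂ < toℕ v

      uncutEdge-preserves-Lower : ∀ e → e ≢ inj₁ i₁ → e ≢ inj₂ (inj₁ i₂) →
        Lower (proj₁ (ends e)) ⇔ Lower (proj₂ (ends e))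
      uncutEdge-preserves-Lower (inj₁ i)        e≢₁ _   = <suc⇔<inject₁ (λ { refl → e≢₁ refl })
      uncutEdge-preserves-Lower (inj₂ (inj₁ i)) _   e≢₂ = <suc⇔<inject₁ (λ { refl → e≢₂ refl })
      uncutEdge-preserves-Lower (inj₂ (inj₂ u)) _   _   =
        ⇔.trans (belowCut₁⇔inPrefix u) (⇔.trans (⇔.sym (σ-prefix⇔ u)) (⇔.sym (belowCut₂⇔inPrefix (σ u))))

      path-preserves-Lower : ∀ {x y} → Path x y → Lower x → Lower y
      path-preserves-Lower ε                                   lower-x = lower-x
      path-preserves-Lower ((e , e≢₁ , e≢₂ , inj₁ refl) ◅ path) lower-x =
        path-preserves-Lower path (to (uncutEdge-preserves-Lower e e≢₁ e≢₂) lower-x)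
      path-preserves-Lower ((e , e≢₁ , e≢₂ , inj₂ refl) ◅ path) lower-x =
        path-preserves-Lower path (from (uncutEdge-preserves-Lower e e≢₁ e≢₂) lower-x)

      lower₁-isolated : ∀ {x} → ¬ Lower x → ¬ Path lower₁ x
      lower₁-isolated ¬lower-x path = ¬lower-x (path-preserves-Lower path ≤-refl)

      last : Fin (suc k')
      last = fromℕ k'

      j<last : toℕ j < toℕ last
      j<last = subst (toℕ j <_) (sym (toℕ-fromℕ k')) (toℕ<n j)

      root₂→root₁ : Path root₂ root₁
      root₂→root₁ =
        reversePath (leaf₂→root (σ last) j<σlast)
        ◅◅ reversePath (glueEdge last) ◅◅ leaf₁→root last j<last
        where
          j<σlast : toℕ j < toℕ (σ last)
          j<σlast = ≰⇒> (λ σlast≤j → <⇒≱ j<last (to (σ-prefix⇔ last) σlast≤j))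

      lower₂→lower₁ : Path lower₂ lower₁
      lower₂→lower₁ =
        reversePath (leaf₂→lower (σ zero) (from (σ-prefix⇔ zero) z≤n))
        ◅◅ reversePath (glueEdge zero) ◅◅ leaf₁→lower zero z≤n

      reaches-root₁-or-lower₁ : ∀ x → Path x root₁ ⊎ Path x lower₁
      reaches-root₁-or-lower₁ (inj₁ v) = reaches₁ v
      reaches-root₁-or-lower₁ (inj₂ v) with reaches₂ v
      ... | inj₁ v→root₂  = inj₁ (v→root₂ ◅◅ root₂→root₁)
      ... | inj₂ v→lower₂ = inj₂ (v→lower₂ ◅◅ lower₂→lower₁)

      atMostTwoComponents : ∀ x y z → Path x y ⊎ Path y z ⊎ Path x z
      atMostTwoComponents x y z
        with reaches-root₁-or-lower₁ x | reaches-root₁-or-lower₁ y | reaches-root₁-or-lower₁ z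
      ... | inj₁ x↝ | inj₁ y↝ | _       = inj₁ (x↝ ◅◅ reversePath y↝)
      ... | inj₂ x↝ | inj₂ y↝ | _       = inj₁ (x↝ ◅◅ reversePath y↝)
      ... | inj₁ x↝ | inj₂ y↝ | inj₁ z↝ = inj₂ (inj₂ (x↝ ◅◅ reversePath z↝))
      ... | inj₁ x↝ | inj₂ y↝ | inj₂ z↝ = inj₂ (inj₁ (y↝ ◅◅ reversePath z↝))
      ... | inj₂ x↝ | inj₁ y↝ | inj₁ z↝ = inj₂ (inj₁ (y↝ ◅◅ reversePath z↝))
      ... | inj₂ x↝ | inj₁ y↝ | inj₂ z↝ = inj₂ (inj₂ (x↝ ◅◅ reversePath z↝))

  subdivergence⇒commonFixedPrefix : Bijective _≡_ _≡_ σ → Subdivergence →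
    Σ (Fin k') λ j → j ∈ S₁ ∩ S₂ × FixesPrefix σ (suc (toℕ j))
  subdivergence⇒commonFixedPrefix (σ-inj , σ-sur) (i₁ , i₂ , _ , x , x↛root₁ , x↛root₂) =
    j₁ , x∈p∩q⁺ (j₁∈S₁ , subst (_∈ S₂) (sym (toℕ-injective j₁≡j₂)) j₂∈S₂) , fixes
    where
      j₁ = proj₁ (edgeCutsSomePrefix S₁ i₁)
      j₂ = proj₁ (edgeCutsSomePrefix S₂ i₂)
      j₁∈S₁ = proj₁ (proj₂ (edgeCutsSomePrefix S₁ i₁))
      j₂∈S₂ = proj₁ (proj₂ (edgeCutsSomePrefix S₂ i₂))
      open Cut i₁ i₂
      open Leaves (proj₂ (edgeCutsSomePrefix S₁ i₁)) (proj₂ (edgeCutsSomePrefix S₂ i₂))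

      σ⁻¹ : Fin (suc k') → Fin (suc k')
      σ⁻¹ y = proj₁ (σ-sur y)

      σσ⁻¹ : ∀ y → σ (σ⁻¹ y) ≡ y
      σσ⁻¹ y = proj₂ (σ-sur y) refl

      σ⁻¹-injective : Injective _≡_ _≡_ σ⁻¹
      σ⁻¹-injective {y} {y′} eq = trans (sym (σσ⁻¹ y)) (trans (cong σ eq) (σσ⁻¹ y′))

      σσ⁻¹-≤ : ∀ y {a} → toℕ y ≤ a → toℕ (σ (σ⁻¹ y)) ≤ a
      σσ⁻¹-≤ y {a} = subst (λ z → toℕ z ≤ a) (sym (σσ⁻¹ y))

      -- The leaves 0 and σ⁻¹ 0 lie below both cuts, since 0 belongs to every prefix.
      lower₁↝glued : Path lower₁ (inj₂ (lp₂ (σ zero)))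
      lower₁↝glued = reversePath (leaf₁→lower zero z≤n) ◅◅ glueEdge zero

      lower₂↝glued : Path lower₂ (inj₁ (lp₁ (σ⁻¹ zero)))
      lower₂↝glued =
        reversePath (leaf₂→lower (σ (σ⁻¹ zero)) (σσ⁻¹-≤ zero z≤n)) ◅◅ reversePath (glueEdge (σ⁻¹ zero))

      isolated⇒reaches-lowers : ∀ v → ¬ Path v root₁ → ¬ Path v root₂ → Path v lower₁ × Path v lower₂
      isolated⇒reaches-lowers (inj₁ v) v↛root₁ v↛root₂ with reaches₁ v
      ... | inj₁ ↝root₁  = ⊥-elim (v↛root₁ ↝root₁)
      ... | inj₂ ↝lower₁ with reaches₂ (lp₂ (σ zero))
      ...   | inj₁ ↝root₂  = ⊥-elim (v↛root₂ (↝lower₁ ◅◅ lower₁↝glued ◅◅ ↝root₂))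
      ...   | inj₂ ↝lower₂ = ↝lower₁ , ↝lower₁ ◅◅ lower₁↝glued ◅◅ ↝lower₂
      isolated⇒reaches-lowers (inj₂ v) v↛root₁ v↛root₂ with reaches₂ v
      ... | inj₁ ↝root₂  = ⊥-elim (v↛root₂ ↝root₂)
      ... | inj₂ ↝lower₂ with reaches₁ (lp₁ (σ⁻¹ zero))
      ...   | inj₁ ↝root₁  = ⊥-elim (v↛root₁ (↝lower₂ ◅◅ lower₂↝glued ◅◅ ↝root₁))
      ...   | inj₂ ↝lower₁ = ↝lower₂ ◅◅ lower₂↝glued ◅◅ ↝lower₁ , ↝lower₂

      x↝lower₁ : Path x lower₁
      x↝lower₁ = proj₁ (isolated⇒reaches-lowers x x↛root₁ x↛root₂)

      x↝lower₂ : Path x lower₂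
      x↝lower₂ = proj₂ (isolated⇒reaches-lowers x x↛root₁ x↛root₂)

      σ-prefix→ : ∀ u → toℕ u ≤ toℕ j₁ → toℕ (σ u) ≤ toℕ j₂
      σ-prefix→ u u≤j₁ with toℕ (σ u) ≤? toℕ j₂
      ... | yes σu≤j₂ = σu≤j₂
      ... | no  σu≰j₂ = ⊥-elim (x↛root₂
        (x↝lower₁ ◅◅ reversePath (leaf₁→lower u u≤j₁) ◅◅ glueEdge u ◅◅ leaf₂→root (σ u) (≰⇒> σu≰j₂)))

      σ-prefix← : ∀ u → toℕ (σ u) ≤ toℕ j₂ → toℕ u ≤ toℕ j₁
      σ-prefix← u σu≤j₂ with toℕ u ≤? toℕ j₁
      ... | yes u≤j₁ = u≤j₁
      ... | no  u≰j₁ = ⊥-elim (x↛root₁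
        (x↝lower₂ ◅◅ reversePath (leaf₂→lower (σ u) σu≤j₂) ◅◅ reversePath (glueEdge u)
          ◅◅ leaf₁→root u (≰⇒> u≰j₁)))

      σ⁻¹-prefix→ : ∀ y → toℕ y ≤ toℕ j₂ → toℕ (σ⁻¹ y) ≤ toℕ j₁
      σ⁻¹-prefix→ y y≤j₂ = σ-prefix← (σ⁻¹ y) (σσ⁻¹-≤ y y≤j₂)

      j₁≡j₂ : toℕ j₁ ≡ toℕ j₂
      j₁≡j₂ = ≤-antisym
        (prefix-injection⇒≤ σ-inj        (m<n⇒m<1+n (toℕ<n j₁)) σ-prefix→)
        (prefix-injection⇒≤ σ⁻¹-injective (m<n⇒m<1+n (toℕ<n j₂)) σ⁻¹-prefix→)

      fixes : FixesPrefix σ (suc (toℕ j₁))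
      fixes =
        (λ u u≤j₁ → s≤s (subst (toℕ (σ u) ≤_) (sym j₁≡j₂) (σ-prefix→ u (s≤s⁻¹ u≤j₁)))) ,
        λ y y≤j₁ → σ⁻¹ y , s≤s (σ⁻¹-prefix→ y (subst (toℕ y ≤_) j₁≡j₂ (s≤s⁻¹ y≤j₁))) , σσ⁻¹ y

prefixAvoiding⇔noSubdivergence : ∀ {k'} (S₁ S₂ : Subset k') σ →
  PrefixAvoiding (S₁ ∩ S₂) σ ⇔ (Bijective _≡_ _≡_ σ × ¬ Glue.Subdivergence (ladder k' S₁) (ladder k' S₂) σ)
prefixAvoiding⇔noSubdivergence S₁ S₂ σ = mk⇔
  (λ (bij , avoids) → bij , λ sub →
    let (j , j∈S₁∩S₂ , fixes) = subdivergence⇒commonFixedPrefix bij sub in avoids j j∈S₁∩S₂ fixes)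
  (λ (bij , no-sub) → bij , λ j j∈S₁∩S₂ fixes →
    let (j∈S₁ , j∈S₂) = x∈p∩q⁻ S₁ S₂ j∈S₁∩S₂ in
    no-sub (commonFixedPrefix⇒subdivergence (proj₁ bij) j∈S₁ j∈S₂ fixes))
  where open LadderGluing S₁ S₂ σ

mainTheorem3 : (k' : ℕ) (S₁ S₂ : Subset k') →
    Σ ℕ λ N → NCount (ladder k' S₁) (ladder k' S₂) N × CCount k' (S₁ ∩ S₂) N
mainTheorem3 k' S₁ S₂ =
  let (N , c-count) = count in
  N , HasCount-cong (prefixAvoiding⇔noSubdivergence S₁ S₂) c-count , c-count
  where open Counting (prefixAvoiding? (S₁ ∩ S₂)) (prefixAvoiding-resp-≗ (S₁ ∩ S₂))
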